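{- Let $a\ge 1$ and $n\ge 2$ be integers, and let $\overline{Fan}_n$ be the graph obtained from the path graph $P_n$ with vertices $p_1,\dots,p_n$ by adding a new vertex $p$ joined to each $p_j$ by $a$ parallel edges. Then $t(\overline{Fan}_n)=a\,B_{n-1}(a)$. In particular, for $a=1$, $t(Fan_n)=F_{2n}$, where $F_k$ is the $k$-th Fibonacci number.
   Context: $t(H)$ denotes the number of spanning trees of a graph $H$. The Morgan–Voyce polynomials are defined by $B_0(x)=1$, $B_1(x)=2+x$, $B_n(x)=(x+2)B_{n-1}(x)-B_{n-2}(x)$ for $n\ge 2$. $Fan_n$ denotes $\overline{Fan}_n$ with $a=1$. Fibonacci numbers: $F_1=F_2=1$, $F_k=F_{k-1}+F_{k-2}$. -}

module Defs where

open import Data.Nat using (ℕ; zero; suc; _*_; _+_)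
open import Data.Integer as ℤ using (ℤ; +_)
open import Data.Fin using (Fin; zero; suc; inject₁; remQuot; splitAt)
open import Data.Fin.Subset using (Subset; _∈_)
open import Data.Product using (Σ; _×_; _,_; proj₁)
open import Data.Sum using (_⊎_; inj₁; inj₂)
open import Data.List using (List; []; _∷_; length)
import Data.List.Membership.Propositional as LM
open import Data.List.Relation.Unary.Unique.Propositional using (Unique)
open import Data.Empty using (⊥)
open import Relation.Binary.PropositionalEquality using (_≡_)
open import Function.Bundles using (_⇔_)

record Graph : Set where
  field
    V     : ℕ
    m     : ℕ
    edge  : Fin m → Fin V × Fin V
open Graph public

Joins : {V : ℕ} → Fin V × Fin V → Fin V → Fin V → Set
Joins (x , y) u w = (x ≡ u × y ≡ w) ⊎ (x ≡ w × y ≡ u)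

data Walk (G : Graph) (S : Subset (m G)) : Fin (V G) → Fin (V G) → List (Fin (m G)) → Set where
  nil  : ∀ {u} → Walk G S u u []
  cons : ∀ {u w v es} (e : Fin (m G)) → e ∈ S → Joins (edge G e) u w →
         Walk G S w v es → Walk G S u v (e ∷ es)

Connected : (G : Graph) → Subset (m G) → Set
Connected G S = ∀ u v → Σ (List (Fin (m G))) λ es → Walk G S u v es

Acyclic : (G : Graph) → Subset (m G) → Set
Acyclic G S = ∀ u e es → Walk G S u u (e ∷ es) → Unique (e ∷ es) → ⊥

IsSpanningTree : (G : Graph) → Subset (m G) → Set
IsSpanningTree G S = Connected G S × Acyclic G S

SpanningTreeCount : Graph → ℕ → Set
SpanningTreeCount G k =
  Σ (List (Subset (m G))) λ L →
    Unique L × (∀ S → (S LM.∈ L) ⇔ IsSpanningTree G S) × length L ≡ k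

B : ℕ → ℤ → ℤ
B zero x = + 1
B (suc zero) x = + 2 ℤ.+ x
B (suc (suc n)) x = (x ℤ.+ + 2) ℤ.* B (suc n) x ℤ.- B n x

fib : ℕ → ℕ
fib zero = 0
fib (suc zero) = 1
fib (suc (suc n)) = fib (suc n) + fib n

-- Vertices: zero = p, suc j = p_{j+1} (j < n).
-- Edges: first n-1 path edges p_{j+1} p_{j+2}, then n*a spokes
-- (spoke i joins p to p_{r+1} where (r , _) = remQuot a i, so a per p_j).
fan : ℕ → ℕ → Graph
fan zero a = record { V = 1 ; m = 0 ; edge = λ () }
fan (suc k) a = record { V = suc (suc k) ; m = k + suc k * a ; edge = ed }
  where
    ed : Fin (k + suc k * a) → Fin (suc (suc k)) × Fin (suc (suc k))
    ed i with splitAt k i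
    ... | inj₁ j = suc (inject₁ j) , suc (suc j)
    ... | inj₂ s = zero , suc (proj₁ (remQuot a s))

-- Root a spanning tree of the fan at the hub p. Every path vertex p_j then hangs off its
-- tree-parent, which is the hub (through one of the a spokes at p_j) or the left or right path
-- neighbour of p_j, and the tree is determined by this labelling. The labellings that occur are
-- exactly the words over {spoke₁, …, spokeₐ, left, right} in which no right is immediately
-- followed by left, that do not start with left and do not end with right. Let r(n) and u(n)
-- count the words of length n with these properties that may follow a right letter, resp. any
-- other letter. Then r(n+1) = a·u(n) + r(n) and u(n+1) = a·u(n) + u(n) + r(n), so by the
-- Morgan–Voyce recurrence r(n) = a·B_{n-1}(a) and u(n) = B_n(a) − B_{n-1}(a); for a = 1 these
-- are F_{2n} and F_{2n+1}.

module Submission where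

open import Defs
open import Data.Nat using (ℕ; zero; suc; _+_; _*_; _∸_; _<_; _≤_; s≤s; z≤n)
import Data.Nat.Properties as ℕ
open import Data.Nat.ListAction using (sum)
open import Data.Nat.ListAction.Properties using (sum-++)
open import Data.Integer as ℤ using (ℤ; +_)
open import Data.Integer.Properties using (pos-+; pos-*)
open import Data.Integer.Tactic.RingSolver using (solve-∀)
open import Data.Bool using (Bool; true; false; _∧_; _∨_)
open import Data.Bool.Properties using (∧-identityʳ; ∨-identityʳ; ∨-zeroʳ; ⇔→≡)
open import Data.Fin
  using (Fin; zero; suc; toℕ; fromℕ; inject₁; lower₁; _↑ˡ_; _↑ʳ_; splitAt; remQuot; combine; join)
  renaming (_≟_ to _≟ᶠ_)
open import Data.Fin.Properties
  using (toℕ-injective; toℕ-fromℕ; toℕ-inject₁; toℕ-lower₁; inject₁-lower₁; lower₁-inject₁′; toℕ<n;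
         splitAt-↑ˡ; splitAt-↑ʳ; join-splitAt; remQuot-combine; combine-remQuot;
         ↑ˡ-injective; ↑ʳ-injective; combine-injective)
open import Data.Fin.Induction using (<-weakInduction; >-weakInduction)
open import Data.Fin.Subset using (Subset) renaming (_∈_ to _∈ₛ_)
open import Data.Vec using (Vec; []; _∷_; lookup; tabulate)
open import Data.Vec.Properties using (∷-injectiveʳ; lookup∘tabulate; []=⇒lookup; lookup⇒[]=)
open import Data.Vec.Relation.Binary.Pointwise.Extensional using (ext; Pointwise-≡⇒≡)
open import Data.List using (List; []; _∷_; _++_; map; concatMap; length; allFin)
open import Data.List.Properties using (length-map; length-++; length-tabulate; map-++; map-cong; map-∘)
open import Data.List.Membership.Propositional using (_∈_; find; lose)
open import Data.List.Membership.Propositional.Properties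
  using (∈-map⁺; ∈-map⁻; ∈-++⁺ˡ; ∈-++⁺ʳ; ∈-++⁻; ∈-allFin; ∈-concatMap⁺; ∈-concatMap⁻)
open import Data.List.Relation.Unary.Any using (here; there)
open import Data.List.Relation.Unary.All as All using (All; []; _∷_)
import Data.List.Relation.Unary.All.Properties as Allₚ
open import Data.List.Relation.Unary.AllPairs as AllPairs using ([]; _∷_)
import Data.List.Relation.Unary.AllPairs.Properties as AllPairsₚ
open import Data.List.Relation.Unary.Unique.Propositional using (Unique)
import Data.List.Relation.Unary.Unique.Propositional.Properties as Unique
open import Data.Product using (Σ; ∃; _×_; _,_; proj₁; proj₂)
open import Data.Sum using (_⊎_; inj₁; inj₂; [_,_]′)
open import Data.Empty using (⊥)
import Data.Empty.Irrelevant as Irrelevant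
open import Function using (_∘_; id)
open import Function.Bundles using (_⇔_; mk⇔; Equivalence)
import Function.Properties.Equivalence as ⇔
open import Relation.Nullary using (¬_; yes; no; does; contradiction)
open import Relation.Binary.Definitions using (tri<; tri≈; tri>)
open import Relation.Binary.PropositionalEquality

-- Walks and a criterion for spanning trees

Joins-sym : ∀ {n} {x y u w : Fin n} → Joins (x , y) u w → Joins (x , y) w u
Joins-sym (inj₁ x≡u×y≡w) = inj₂ x≡u×y≡w
Joins-sym (inj₂ x≡w×y≡u) = inj₁ x≡w×y≡u

Joins-unique : ∀ {n} {x y u w u′ w′ : Fin n} → Joins (x , y) u w → Joins (x , y) u′ w′ →
               (u ≡ u′ × w ≡ w′) ⊎ (u ≡ w′ × w ≡ u′)
Joins-unique (inj₁ (refl , refl)) (inj₁ (refl , refl)) = inj₁ (refl , refl)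
Joins-unique (inj₁ (refl , refl)) (inj₂ (refl , refl)) = inj₂ (refl , refl)
Joins-unique (inj₂ (refl , refl)) (inj₁ (refl , refl)) = inj₂ (refl , refl)
Joins-unique (inj₂ (refl , refl)) (inj₂ (refl , refl)) = inj₁ (refl , refl)

module _ {G : Graph} {S : Subset (m G)} where

  _++ʷ_ : ∀ {u v w es fs} → Walk G S u v es → Walk G S v w fs → Walk G S u w (es ++ fs)
  nil ++ʷ q = q
  cons e e∈S j p ++ʷ q = cons e e∈S j (p ++ʷ q)

  reverseWalk : ∀ {u v es} → Walk G S u v es → ∃ (Walk G S v u)
  reverseWalk nil = [] , nil
  reverseWalk (cons e e∈S j p) with reverseWalk p
  ... | fs , q = fs ++ e ∷ [] , q ++ʷ cons e e∈S (Joins-sym j) nil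

  walk-preserves : (P : Fin (V G) → Set) (e₀ : Fin (m G)) →
    (∀ e → e ∈ₛ S → e₀ ≢ e → ∀ {x y} → Joins (edge G e) x y → P x ⇔ P y) →
    ∀ {u v es} → Walk G S u v es → All (e₀ ≢_) es → P u ⇔ P v
  walk-preserves P e₀ step nil [] = ⇔.refl
  walk-preserves P e₀ step (cons e e∈S j p) (e₀≢e ∷ rest) =
    ⇔.trans (step e e∈S e₀≢e j) (walk-preserves P e₀ step p rest)

record ParentPointers (G : Graph) (S : Subset (m G)) : Set where
  field
    root             : Fin (V G)
    depth            : Fin (V G) → ℕ
    parent           : Fin (V G) → Fin (V G)
    parentEdge       : (v : Fin (V G)) → .(v ≢ root) → Fin (m G)
    parentEdge∈S     : ∀ v .(v≢r : v ≢ root) → parentEdge v v≢r ∈ₛ S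
    parentEdge-joins : ∀ v .(v≢r : v ≢ root) → Joins (edge G (parentEdge v v≢r)) v (parent v)
    depth-parent     : ∀ v → v ≢ root → depth (parent v) < depth v
    parentEdge-onto  : ∀ e → e ∈ₛ S → Σ (Fin (V G)) λ v → Σ (v ≢ root) λ v≢r → parentEdge v v≢r ≡ e

module _ {G : Graph} {S : Subset (m G)} (T : ParentPointers G S) where
  open ParentPointers T

  walkToRoot : ∀ fuel v → depth v < fuel → ∃ λ es → Walk G S v root es
  walkToRoot (suc fuel) v d<fuel with v ≟ᶠ root
  ... | yes refl = [] , nil
  ... | no v≢r with walkToRoot fuel (parent v) (ℕ.<-≤-trans (depth-parent v v≢r) (ℕ.≤-pred d<fuel))
  ... | es , w = parentEdge v v≢r ∷ es , cons _ (parentEdge∈S v v≢r) (parentEdge-joins v v≢r) w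

  connected : Connected G S
  connected u v with walkToRoot _ u ℕ.≤-refl | walkToRoot _ v ℕ.≤-refl
  ... | es , u⇝r | _ , v⇝r with reverseWalk v⇝r
  ... | fs , r⇝v = es ++ fs , u⇝r ++ʷ r⇝v

  data Descendant (v : Fin (V G)) : Fin (V G) → Set where
    self  : Descendant v v
    child : ∀ {x} → x ≢ root → Descendant v (parent x) → Descendant v x

  depth-descendant : ∀ {v x} → Descendant v x → depth v ≤ depth x
  depth-descendant self = ℕ.≤-refl
  depth-descendant (child x≢r d) = ℕ.<⇒≤ (ℕ.≤-<-trans (depth-descendant d) (depth-parent _ x≢r))

  parent-not-descendant : ∀ v → v ≢ root → ¬ Descendant v (parent v)
  parent-not-descendant v v≢r d = ℕ.<-irrefl refl (ℕ.≤-<-trans (depth-descendant d) (depth-parent v v≢r))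

  descendant-parent : ∀ {v x} → x ≢ v → Descendant v x → Descendant v (parent x)
  descendant-parent x≢v self = contradiction refl x≢v
  descendant-parent x≢v (child _ d) = d

  -- Only the edge to the parent of v separates the descendants of v from the other vertices.
  descendant-preserved : ∀ v .(v≢r : v ≢ root) → ∀ e → e ∈ₛ S → parentEdge v v≢r ≢ e →
    ∀ {x y} → Joins (edge G e) x y → Descendant v x ⇔ Descendant v y
  descendant-preserved v v≢r e e∈S pe≢e {x} {y} j with parentEdge-onto e e∈S
  ... | w , w≢r , refl with w ≟ᶠ v
  ... | yes refl = contradiction refl pe≢e
  ... | no w≢v with Joins-unique j (parentEdge-joins w w≢r)
  ... | inj₁ (refl , refl) = mk⇔ (descendant-parent w≢v) (child w≢r)
  ... | inj₂ (refl , refl) = mk⇔ (child w≢r) (descendant-parent w≢v)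

  acyclic : Acyclic G S
  acyclic u e es (cons e e∈S j w) (e∉es ∷ _) with parentEdge-onto e e∈S
  ... | v , v≢r , refl with Joins-unique j (parentEdge-joins v v≢r)
  ... | inj₁ (refl , refl) = parent-not-descendant v v≢r
          (Equivalence.from (walk-preserves (Descendant v) _ (descendant-preserved v v≢r) w e∉es) self)
  ... | inj₂ (refl , refl) = parent-not-descendant v v≢r
          (Equivalence.to (walk-preserves (Descendant v) _ (descendant-preserved v v≢r) w e∉es) self)

  parentPointers⇒spanningTree : IsSpanningTree G S
  parentPointers⇒spanningTree = connected , acyclic

module _ {A B : Set} where

  concatMap-unique : (f : A → List B) {xs : List A} → Unique xs → (∀ x → Unique (f x)) →
    (∀ {x y z} → z ∈ f x → z ∈ f y → x ≡ y) → Unique (concatMap f xs)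
  concatMap-unique f xs! f! disjoint =
    Unique.concat⁺ (Allₚ.map⁺ (All.tabulate (λ {x} _ → f! x)))
                   (AllPairsₚ.map⁺ (AllPairs.map (λ x≢y {_} (z∈fx , z∈fy) → x≢y (disjoint z∈fx z∈fy)) xs!))

  length-concatMap : (f : A → List B) (xs : List A) → length (concatMap f xs) ≡ sum (map (length ∘ f) xs)
  length-concatMap f [] = refl
  length-concatMap f (x ∷ xs) = trans (length-++ (f x)) (cong (λ n → length (f x) + n) (length-concatMap f xs))

sum-map-const : ∀ {A : Set} (c : ℕ) (xs : List A) → sum (map (λ _ → c) xs) ≡ length xs * c
sum-map-const c [] = refl
sum-map-const c (x ∷ xs) = cong (λ n → c + n) (sum-map-const c xs)

map-unique-on : ∀ {A B : Set} {P : A → Set} (f : A → B) {xs : List A} →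
  (∀ {x y} → P x → P y → f x ≡ f y → x ≡ y) → All P xs → Unique xs → Unique (map f xs)
map-unique-on f injective [] [] = []
map-unique-on {P = P} f injective (px ∷ pxs) (x∉xs ∷ xs!) = fresh px pxs x∉xs ∷ map-unique-on f injective pxs xs!
  where
  fresh : ∀ {x ys} → P x → All P ys → All (x ≢_) ys → All (f x ≢_) (map f ys)
  fresh px [] [] = []
  fresh px (py ∷ pys) (x≢y ∷ x≢ys) = (λ fx≡fy → x≢y (injective px py fx≡fy)) ∷ fresh px pys x≢ys

-- Labellings of the path vertices

data Label (a : ℕ) : Set where
  hub : Fin a → Label a
  left right : Label a

module _ {a : ℕ} where

  isLeft isRight : Label a → Bool
  isLeft left = true
  isLeft _    = false
  isRight right = true
  isRight _     = false

  usesSpoke : Fin a → Label a → Bool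
  usesSpoke c (hub c′) = does (c ≟ᶠ c′)
  usesSpoke c _          = false

  usesSpoke-hub : ∀ c → usesSpoke c (hub c) ≡ true
  usesSpoke-hub c with c ≟ᶠ c
  ... | yes _  = refl
  ... | no c≢c = contradiction refl c≢c

  usesSpoke⇒≡hub : ∀ c x → usesSpoke c x ≡ true → x ≡ hub c
  usesSpoke⇒≡hub c (hub c′) h with c ≟ᶠ c′
  ... | yes refl = refl

  isLeft⇒≡left : ∀ x → isLeft x ≡ true → x ≡ left
  isLeft⇒≡left left _ = refl

  isRight⇒≡right : ∀ x → isRight x ≡ true → x ≡ right
  isRight⇒≡right right _ = refl

  -- A right-labelled vertex hangs off its right neighbour, which therefore cannot be left-labelled.
  Follows : Bool → Label a → Set
  Follows afterRight x = afterRight ∧ isLeft x ≡ false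

  hubLabels : List (Label a)
  hubLabels = map hub (allFin a)

  pathLabels : Bool → List (Label a)
  pathLabels true  = right ∷ []
  pathLabels false = left ∷ right ∷ []

  successors : Bool → List (Label a)
  successors r = hubLabels ++ pathLabels r

  ∈successors⇔Follows : ∀ r x → x ∈ successors r ⇔ Follows r x
  ∈successors⇔Follows r x = mk⇔ (to r x) (from r x)
    where
    to : ∀ r x → x ∈ successors r → Follows r x
    to false x _ = refl
    to true x x∈ with ∈-++⁻ hubLabels x∈
    ... | inj₁ x∈hubLabels with ∈-map⁻ hub x∈hubLabels
    ... | _ , _ , refl = refl
    to true x x∈ | inj₂ (here refl) = refl
    from : ∀ r x → Follows r x → x ∈ successors r
    from r     (hub c) _ = ∈-++⁺ˡ (∈-map⁺ hub (∈-allFin c))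
    from false left      _ = ∈-++⁺ʳ hubLabels (here refl)
    from true  right     _ = ∈-++⁺ʳ hubLabels (here refl)
    from false right     _ = ∈-++⁺ʳ hubLabels (there (here refl))

  successors-unique : ∀ r → Unique (successors r)
  successors-unique r = Unique.++⁺ (Unique.map⁺ (λ { refl → refl }) (Unique.allFin⁺ a)) (pathLabels-unique r) hubLabels-disjoint
    where
    pathLabels-unique : ∀ r → Unique (pathLabels r)
    pathLabels-unique true  = [] ∷ []
    pathLabels-unique false = ((λ ()) ∷ []) ∷ [] ∷ []
    hub∉pathLabels : ∀ r {c} → hub c ∈ pathLabels r → ⊥
    hub∉pathLabels true  (here ())
    hub∉pathLabels false (here ())
    hub∉pathLabels false (there (here ()))
    hubLabels-disjoint : ∀ {x} → ¬ (x ∈ hubLabels × x ∈ pathLabels r)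
    hubLabels-disjoint (x∈hubLabels , x∈pathLabels) with ∈-map⁻ hub x∈hubLabels
    ... | _ , _ , refl = hub∉pathLabels r x∈pathLabels

  -- The empty chain may only follow a non-right label: this forces the last label not to be right.
  data Chain : ∀ {n} → Bool → Vec (Label a) n → Set where
    []  : Chain false []
    _∷_ : ∀ {n r x} {σ : Vec (Label a) n} → Follows r x → Chain (isRight x) σ → Chain r (x ∷ σ)

  chains : (n : ℕ) → Bool → List (Vec (Label a) n)
  chains zero    true  = []
  chains zero    false = [] ∷ []
  chains (suc n) r     = concatMap (λ x → map (x ∷_) (chains n (isRight x))) (successors r)

  ∈chains⇔Chain : ∀ n r (σ : Vec (Label a) n) → σ ∈ chains n r ⇔ Chain r σ
  ∈chains⇔Chain n r σ = mk⇔ (to n r σ) (from n r σ)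
    where
    to : ∀ n r (σ : Vec (Label a) n) → σ ∈ chains n r → Chain r σ
    to zero false [] _ = []
    to (suc n) r σ σ∈ with find (∈-concatMap⁻ _ {xs = successors r} σ∈)
    ... | x , x∈ , σ∈x with ∈-map⁻ (x ∷_) σ∈x
    ... | τ , τ∈ , refl = Equivalence.to (∈successors⇔Follows r x) x∈ ∷ to n (isRight x) τ τ∈
    from : ∀ n r (σ : Vec (Label a) n) → Chain r σ → σ ∈ chains n r
    from zero false [] [] = here refl
    from (suc n) r (x ∷ σ) (x-follows ∷ chain) =
      ∈-concatMap⁺ _ {xs = successors r}
        (lose (Equivalence.from (∈successors⇔Follows r x) x-follows) (∈-map⁺ (x ∷_) (from n _ σ chain)))

  chains-unique : ∀ n r → Unique (chains n r)
  chains-unique zero    true  = []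
  chains-unique zero    false = [] ∷ []
  chains-unique (suc n) r = concatMap-unique _ (successors-unique r)
    (λ x → Unique.map⁺ ∷-injectiveʳ (chains-unique n (isRight x))) same-head
    where
    same-head : ∀ {x y σ} → σ ∈ map (x ∷_) (chains n (isRight x)) → σ ∈ map (y ∷_) (chains n (isRight y)) → x ≡ y
    same-head σ∈x σ∈y with ∈-map⁻ _ σ∈x | ∈-map⁻ _ σ∈y
    ... | _ , _ , refl | _ , _ , refl = refl

  followCount : (Bool → ℕ) → Bool → ℕ
  followCount h true  = a * h false + h true
  followCount h false = a * h false + (h false + h true)

  chainCount : ℕ → Bool → ℕ
  chainCount zero    true  = 0
  chainCount zero    false = 1
  chainCount (suc n)       = followCount (chainCount n)

  sum-successors : ∀ (h : Bool → ℕ) r → sum (map (h ∘ isRight) (successors r)) ≡ followCount h r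
  sum-successors h r = begin
    sum (map g (hubLabels ++ pathLabels r))             ≡⟨ cong sum (map-++ g hubLabels (pathLabels r)) ⟩
    sum (map g hubLabels ++ map g (pathLabels r))       ≡⟨ sum-++ (map g hubLabels) (map g (pathLabels r)) ⟩
    sum (map g hubLabels) + sum (map g (pathLabels r))  ≡⟨ cong (_+ sum (map g (pathLabels r))) hubLabels-sum ⟩
    a * h false + sum (map g (pathLabels r))            ≡⟨ pathLabels-sum r ⟩
    followCount h r                                     ∎
    where
    open ≡-Reasoning
    g : Label a → ℕ
    g = h ∘ isRight
    hubLabels-sum : sum (map g hubLabels) ≡ a * h false
    hubLabels-sum = begin
      sum (map g (map hub (allFin a)))      ≡⟨ cong sum (sym (map-∘ {g = g} {f = hub} (allFin a))) ⟩
      sum (map (λ _ → h false) (allFin a))  ≡⟨ sum-map-const (h false) (allFin a) ⟩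
      length (allFin a) * h false           ≡⟨ cong (_* h false) (length-tabulate {n = a} id) ⟩
      a * h false                           ∎
    pathLabels-sum : ∀ r → a * h false + sum (map g (pathLabels r)) ≡ followCount h r
    pathLabels-sum true  = cong (λ t → a * h false + t) (ℕ.+-identityʳ (h true))
    pathLabels-sum false = cong (λ t → a * h false + (h false + t)) (ℕ.+-identityʳ (h true))

  length-chains : ∀ n r → length (chains n r) ≡ chainCount n r
  length-chains zero    true  = refl
  length-chains zero    false = refl
  length-chains (suc n) r = begin
    length (concatMap f (successors r))                ≡⟨ length-concatMap f (successors r) ⟩
    sum (map (length ∘ f) (successors r))              ≡⟨ cong sum (map-cong length-f (successors r)) ⟩
    sum (map (chainCount n ∘ isRight) (successors r))  ≡⟨ sum-successors (chainCount n) r ⟩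
    chainCount (suc n) r                               ∎
    where
    open ≡-Reasoning
    f : Label a → List (Vec (Label a) (suc n))
    f x = map (x ∷_) (chains n (isRight x))
    length-f : ∀ x → length (f x) ≡ chainCount n (isRight x)
    length-f x = trans (length-map (x ∷_) (chains n (isRight x))) (length-chains n (isRight x))

  record Valid {n} (afterRight : Bool) (σ : Vec (Label a) (suc n)) : Set where
    field
      head-follows     : Follows afterRight (lookup σ zero)
      last-notRight    : isRight (lookup σ (fromℕ n)) ≡ false
      adjacent-follows : ∀ l → Follows (isRight (lookup σ (inject₁ l))) (lookup σ (suc l))

  Chain⇔Valid : ∀ {n} r (σ : Vec (Label a) (suc n)) → Chain r σ ⇔ Valid r σ
  Chain⇔Valid r σ = mk⇔ (to r σ) (from r σ)
    where
    open Valid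
    end : ∀ {r} → Chain r [] → r ≡ false
    end [] = refl
    to : ∀ {n} r (σ : Vec (Label a) (suc n)) → Chain r σ → Valid r σ
    to r (x ∷ [])    (x-follows ∷ rest) = record
      { head-follows = x-follows ; last-notRight = end rest ; adjacent-follows = λ () }
    to r (x ∷ y ∷ σ) (x-follows ∷ rest) with to (isRight x) (y ∷ σ) rest
    ... | valid = record
      { head-follows     = x-follows
      ; last-notRight    = last-notRight valid
      ; adjacent-follows = λ { zero → head-follows valid ; (suc l) → adjacent-follows valid l } }
    from : ∀ {n} r (σ : Vec (Label a) (suc n)) → Valid r σ → Chain r σ
    from r (x ∷ [])    valid = head-follows valid ∷ subst (λ r → Chain r []) (sym (last-notRight valid)) []
    from r (x ∷ y ∷ σ) valid = head-follows valid ∷ from (isRight x) (y ∷ σ) record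
      { head-follows     = adjacent-follows valid zero
      ; last-notRight    = last-notRight valid
      ; adjacent-follows = λ l → adjacent-follows valid (suc l) }


  module _ {n r} {σ : Vec (Label a) (suc n)} (valid : Valid r σ) where
    open Valid valid

    right⇒notLast : ∀ j → lookup σ j ≡ right → n ≢ toℕ j
    right⇒notLast j σj≡right n≡j with toℕ-injective (trans (sym n≡j) (sym (toℕ-fromℕ n)))
    ... | refl with trans (sym (cong isRight σj≡right)) last-notRight
    ... | ()

    right⇒nextNotLeft : ∀ l → lookup σ (inject₁ l) ≡ right → isLeft (lookup σ (suc l)) ≡ false
    right⇒nextNotLeft l σl≡right = subst (λ x → isRight x ∧ isLeft (lookup σ (suc l)) ≡ false) σl≡right (adjacent-follows l)

    left⇒previousNotRight : ∀ l → lookup σ (suc l) ≡ left → isRight (lookup σ (inject₁ l)) ≡ false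
    left⇒previousNotRight l σl≡left =
      trans (sym (∧-identityʳ _)) (subst (λ x → isRight (lookup σ (inject₁ l)) ∧ isLeft x ≡ false) σl≡left (adjacent-follows l))

  -- The label of a path vertex j whose segment of the tree hangs off the hub through spoke c at r.
  direction : ∀ {n} (j r : Fin n) → Fin a → Label a
  direction j r c with ℕ.<-cmp (toℕ j) (toℕ r)
  ... | tri< _ _ _ = right
  ... | tri≈ _ _ _ = hub c
  ... | tri> _ _ _ = left

  data DirectionSpec {n} (j r : Fin n) (c : Fin a) : Label a → Set where
    toRight : toℕ j < toℕ r → DirectionSpec j r c right
    toHub   : j ≡ r → DirectionSpec j r c (hub c)
    toLeft  : toℕ r < toℕ j → DirectionSpec j r c left

  direction-spec : ∀ {n} (j r : Fin n) c → DirectionSpec j r c (direction j r c)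
  direction-spec j r c with ℕ.<-cmp (toℕ j) (toℕ r)
  ... | tri< j<r _ _ = toRight j<r
  ... | tri≈ _ j≡r _ = toHub (toℕ-injective j≡r)
  ... | tri> _ _ r<j = toLeft r<j

  module _ {n} (j r : Fin n) (c : Fin a) where

    direction-right⇒< : isRight (direction j r c) ≡ true → toℕ j < toℕ r
    direction-right⇒< with direction j r c | direction-spec j r c
    ... | right | toRight j<r = λ _ → j<r
    ... | hub _ | _           = λ ()
    ... | left  | _           = λ ()

    direction-left⇒< : isLeft (direction j r c) ≡ true → toℕ r < toℕ j
    direction-left⇒< with direction j r c | direction-spec j r c
    ... | left  | toLeft r<j = λ _ → r<j
    ... | hub _ | _          = λ ()
    ... | right | _          = λ ()

    direction-notRight⇒≤ : isRight (direction j r c) ≡ false → toℕ r ≤ toℕ j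
    direction-notRight⇒≤ with direction j r c | direction-spec j r c
    ... | left  | toLeft r<j   = λ _ → ℕ.<⇒≤ r<j
    ... | hub _ | toHub refl   = λ _ → ℕ.≤-refl
    ... | right | _            = λ ()

    direction-<⇒left : toℕ r < toℕ j → direction j r c ≡ left
    direction-<⇒left r<j with direction j r c | direction-spec j r c
    ... | left  | _            = refl
    ... | hub _ | toHub refl   = contradiction r<j (ℕ.<-irrefl refl)
    ... | right | toRight j<r  = contradiction r<j (ℕ.<⇒≯ j<r)

    direction-usesSpoke : ∀ c′ → usesSpoke c′ (direction j r c) ≡ true → j ≡ r × c ≡ c′
    direction-usesSpoke c′ with direction j r c | direction-spec j r c
    ... | hub _ | toHub j≡r = λ uses → j≡r , hub-injective (usesSpoke⇒≡hub c′ (hub c) uses)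
      where hub-injective : ∀ {c c′} → hub c ≡ hub c′ → c ≡ c′
            hub-injective refl = refl
    ... | left  | _ = λ ()
    ... | right | _ = λ ()

  direction-self : ∀ {n} (j : Fin n) c → direction j j c ≡ hub c
  direction-self j c with direction j j c | direction-spec j j c
  ... | hub _ | toHub _     = refl
  ... | left  | toLeft j<j  = contradiction j<j (ℕ.<-irrefl refl)
  ... | right | toRight j<j = contradiction j<j (ℕ.<-irrefl refl)

  label-ext : ∀ x y → (∀ c → usesSpoke c x ≡ usesSpoke c y) → isRight x ≡ isRight y → x ≡ y
  label-ext (hub c) y same-spokes _ = sym (usesSpoke⇒≡hub c y (trans (sym (same-spokes c)) (usesSpoke-hub c)))
  label-ext x (hub c) same-spokes _ = usesSpoke⇒≡hub c x (trans (same-spokes c) (usesSpoke-hub c))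
  label-ext left  left  _ _ = refl
  label-ext right right _ _ = refl
  label-ext left  right _ ()
  label-ext right left  _ ()

-- Predicates holding on an interval of positions

module Intervals (T : ℕ → Set) where

  Between : ℕ → ℕ → ℕ → Set
  Between i x y = (x ≤ i × i < y) ⊎ (y ≤ i × i < x)

  AllBetween : ℕ → ℕ → Set
  AllBetween x y = ∀ i → Between i x y → T i

  AllBetween-refl : ∀ x → AllBetween x x
  AllBetween-refl x i (inj₁ (x≤i , i<x)) = contradiction x≤i (ℕ.<⇒≱ i<x)
  AllBetween-refl x i (inj₂ (x≤i , i<x)) = contradiction x≤i (ℕ.<⇒≱ i<x)

  AllBetween-sym : ∀ {x y} → AllBetween x y → AllBetween y x
  AllBetween-sym all i (inj₁ between) = all i (inj₂ between)
  AllBetween-sym all i (inj₂ between) = all i (inj₁ between)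

  AllBetween-trans : ∀ {x y z} → AllBetween x y → AllBetween y z → AllBetween x z
  AllBetween-trans {x} {y} {z} xy yz i i∈xz with ℕ.≤-<-connex y i | i∈xz
  ... | inj₁ y≤i | inj₁ (_ , i<z)   = yz i (inj₁ (y≤i , i<z))
  ... | inj₂ i<y | inj₁ (x≤i , _)   = xy i (inj₁ (x≤i , i<y))
  ... | inj₁ y≤i | inj₂ (_ , i<x)   = xy i (inj₂ (y≤i , i<x))
  ... | inj₂ i<y | inj₂ (z≤i , _)   = yz i (inj₂ (z≤i , i<y))

  AllBetween-step : ∀ x → T x → AllBetween x (suc x)
  AllBetween-step x Tx i (inj₁ (x≤i , s≤s i≤x)) rewrite ℕ.≤-antisym x≤i i≤x = Tx
  AllBetween-step x Tx i (inj₂ (sx≤i , i<x)) = contradiction (ℕ.<-trans i<x sx≤i) (ℕ.<-irrefl refl)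

  AllBetween-min : ∀ {x y} → AllBetween x y → x < y → T x
  AllBetween-min all x<y = all _ (inj₁ (ℕ.≤-refl , x<y))

  AllBetween-max : ∀ {x y} → AllBetween x (suc y) → x ≤ y → T y
  AllBetween-max all x≤y = all _ (inj₁ (x≤y , ℕ.≤-refl))

  AllBetween-sub : ∀ {x y z} → AllBetween x z → x ≤ y → y ≤ z → AllBetween x y
  AllBetween-sub all x≤y y≤z i (inj₁ (x≤i , i<y)) = all i (inj₁ (x≤i , ℕ.<-≤-trans i<y y≤z))
  AllBetween-sub all x≤y y≤z i (inj₂ (y≤i , i<x)) = contradiction (ℕ.≤-trans x≤y y≤i) (ℕ.<⇒≱ i<x)

-- The fan and the encoding of labellings as edge sets

module Fan (k a : ℕ) where

  G : Graph
  G = fan (suc k) a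

  pathEdge : Fin k → Fin (m G)
  pathEdge l = l ↑ˡ (suc k * a)

  spokeEdge : Fin (suc k) → Fin a → Fin (m G)
  spokeEdge j c = k ↑ʳ combine j c

  edge-pathEdge : ∀ l → edge G (pathEdge l) ≡ (suc (inject₁ l) , suc (suc l))
  edge-pathEdge l rewrite splitAt-↑ˡ k l (suc k * a) = refl

  edge-spokeEdge : ∀ j c → edge G (spokeEdge j c) ≡ (zero , suc j)
  edge-spokeEdge j c rewrite splitAt-↑ʳ k (suc k * a) (combine j c) =
    cong (λ q → zero , suc (proj₁ q)) (remQuot-combine {suc k} {a} j c)

  pathEdge-joins : ∀ l → Joins (edge G (pathEdge l)) (suc (inject₁ l)) (suc (suc l))
  pathEdge-joins l rewrite edge-pathEdge l = inj₁ (refl , refl)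

  spokeEdge-joins : ∀ j c → Joins (edge G (spokeEdge j c)) (suc j) zero
  spokeEdge-joins j c rewrite edge-spokeEdge j c = inj₂ (refl , refl)

  pathEdge-joins⁻ : ∀ l {x y} → Joins (edge G (pathEdge l)) (suc x) y →
                    (x ≡ inject₁ l × y ≡ suc (suc l)) ⊎ (x ≡ suc l × y ≡ suc (inject₁ l))
  pathEdge-joins⁻ l j rewrite edge-pathEdge l with j
  ... | inj₁ (refl , refl) = inj₁ (refl , refl)
  ... | inj₂ (refl , refl) = inj₂ (refl , refl)

  spokeEdge-joins⁻ : ∀ j c {x y} → Joins (edge G (spokeEdge j c)) (suc x) y → x ≡ j × y ≡ zero
  spokeEdge-joins⁻ j c jn rewrite edge-spokeEdge j c with jn
  ... | inj₂ (refl , refl) = refl , refl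

  pathEdge≢spokeEdge : ∀ l j c → pathEdge l ≢ spokeEdge j c
  pathEdge≢spokeEdge l j c eq
    with trans (sym (splitAt-↑ˡ k l (suc k * a))) (trans (cong (splitAt k) eq) (splitAt-↑ʳ k (suc k * a) (combine j c)))
  ... | ()

  spokeEdge-injective : ∀ {j c j′ c′} → spokeEdge j c ≡ spokeEdge j′ c′ → j ≡ j′ × c ≡ c′
  spokeEdge-injective {j} {c} {j′} {c′} eq = combine-injective j c j′ c′ (↑ʳ-injective k _ _ eq)

  data EdgeView : Fin (m G) → Set where
    path  : ∀ l → EdgeView (pathEdge l)
    spoke : ∀ j c → EdgeView (spokeEdge j c)

  edgeView : ∀ e → EdgeView e
  edgeView e = subst EdgeView (join-splitAt k (suc k * a) e) (view (splitAt k e))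
    where
    view : ∀ s → EdgeView (join k (suc k * a) s)
    view (inj₁ l) = path l
    view (inj₂ s) = subst (EdgeView ∘ (k ↑ʳ_)) (combine-remQuot {suc k} a s) (spoke (proj₁ (remQuot a s)) (proj₂ (remQuot a s)))

  -- A labelling records, for every path vertex, where its tree-parent lies; encode selects the
  -- edges from the vertices to their parents.
  selects : Vec (Label a) (suc k) → Fin (m G) → Bool
  selects σ e = [ pathIn , spokeIn ]′ (splitAt k e)
    where
    pathIn : Fin k → Bool
    pathIn l = isRight (lookup σ (inject₁ l)) ∨ isLeft (lookup σ (suc l))
    spokeIn : Fin (suc k * a) → Bool
    spokeIn s = usesSpoke (proj₂ (remQuot {suc k} a s)) (lookup σ (proj₁ (remQuot {suc k} a s)))

  encode : Vec (Label a) (suc k) → Subset (m G)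
  encode σ = tabulate (selects σ)

  encode-pathEdge : ∀ σ l → lookup (encode σ) (pathEdge l) ≡ isRight (lookup σ (inject₁ l)) ∨ isLeft (lookup σ (suc l))
  encode-pathEdge σ l rewrite lookup∘tabulate (selects σ) (pathEdge l) | splitAt-↑ˡ k l (suc k * a) = refl

  encode-spokeEdge : ∀ σ j c → lookup (encode σ) (spokeEdge j c) ≡ usesSpoke c (lookup σ j)
  encode-spokeEdge σ j c rewrite lookup∘tabulate (selects σ) (spokeEdge j c) | splitAt-↑ʳ k (suc k * a) (combine j c) =
    cong (λ q → usesSpoke (proj₂ q) (lookup σ (proj₁ q))) (remQuot-combine {suc k} {a} j c)

  Subset-ext : ∀ (S T : Subset (m G)) → (∀ l → lookup S (pathEdge l) ≡ lookup T (pathEdge l)) →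
               (∀ j c → lookup S (spokeEdge j c) ≡ lookup T (spokeEdge j c)) → S ≡ T
  Subset-ext S T same-path same-spoke = Pointwise-≡⇒≡ (ext same)
    where
    same : ∀ e → lookup S e ≡ lookup T e
    same e with edgeView e
    ... | path l    = same-path l
    ... | spoke j c = same-spoke j c

  -- A labelling is recovered from its encoding from the last vertex backwards: a vertex not
  -- hanging off the hub is right-labelled iff its path edge to the right is selected and the
  -- next vertex is not left-labelled.
  encode-injective : ∀ {σ τ} → Valid true σ → Valid true τ → encode σ ≡ encode τ → σ ≡ τ
  encode-injective {σ} {τ} σ-valid τ-valid σ≈τ = Pointwise-≡⇒≡ (ext (>-weakInduction _ last previous))
    where
    open Valid
    same-spokes : ∀ j c → usesSpoke c (lookup σ j) ≡ usesSpoke c (lookup τ j)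
    same-spokes j c =
      trans (sym (encode-spokeEdge σ j c)) (trans (cong (λ S → lookup S (spokeEdge j c)) σ≈τ) (encode-spokeEdge τ j c))
    same-path : ∀ l → isRight (lookup σ (inject₁ l)) ∨ isLeft (lookup σ (suc l))
                    ≡ isRight (lookup τ (inject₁ l)) ∨ isLeft (lookup τ (suc l))
    same-path l = trans (sym (encode-pathEdge σ l)) (trans (cong (λ S → lookup S (pathEdge l)) σ≈τ) (encode-pathEdge τ l))
    last : lookup σ (fromℕ k) ≡ lookup τ (fromℕ k)
    last = label-ext _ _ (same-spokes (fromℕ k)) (trans (last-notRight σ-valid) (sym (last-notRight τ-valid)))
    previous : ∀ l → lookup σ (suc l) ≡ lookup τ (suc l) → lookup σ (inject₁ l) ≡ lookup τ (inject₁ l)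
    previous l σ≡τ = label-ext _ _ (same-spokes (inject₁ l)) same-right
      where
      same-right : isRight (lookup σ (inject₁ l)) ≡ isRight (lookup τ (inject₁ l))
      same-right with isLeft (lookup τ (suc l)) in τ-next
      ... | false = begin
        isRight σl                               ≡⟨ sym (∨-identityʳ _) ⟩
        isRight σl ∨ false                       ≡⟨ cong (isRight σl ∨_) (sym (trans (cong isLeft σ≡τ) τ-next)) ⟩
        isRight σl ∨ isLeft (lookup σ (suc l))   ≡⟨ same-path l ⟩
        isRight τl ∨ isLeft (lookup τ (suc l))   ≡⟨ cong (isRight τl ∨_) τ-next ⟩
        isRight τl ∨ false                       ≡⟨ ∨-identityʳ _ ⟩
        isRight τl                               ∎
        where
        open ≡-Reasoning
        σl τl : Label a
        σl = lookup σ (inject₁ l)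
        τl = lookup τ (inject₁ l)
      ... | true = trans (left⇒previousNotRight σ-valid l (isLeft⇒≡left _ (trans (cong isLeft σ≡τ) τ-next)))
                         (sym (left⇒previousNotRight τ-valid l (isLeft⇒≡left _ τ-next)))

module FromLabelling (k a : ℕ) (σ : Vec (Label a) (suc k)) (valid : Valid true σ) where
  open Fan k a
  open Valid valid

  -- A right-labelled vertex j is followed by a chain of right labels ending in a hub label,
  -- so k ∸ j bounds its distance to the hub; symmetrically for left labels.
  labelDepth : Fin (suc k) → Label a → ℕ
  labelDepth j (hub _) = 1
  labelDepth j right   = 2 + (k ∸ toℕ j)
  labelDepth j left    = 2 + toℕ j

  depth : Fin (V G) → ℕ
  depth zero    = 0
  depth (suc j) = labelDepth j (lookup σ j)

  record ParentStep (j : Fin (suc k)) (x : Label a) : Set where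
    field
      parent       : Fin (V G)
      edgeTo       : Fin (m G)
      edgeTo∈      : lookup (encode σ) edgeTo ≡ true
      edgeTo-joins : Joins (edge G edgeTo) (suc j) parent
      depth<       : depth parent < labelDepth j x

  parentStep : ∀ j x → lookup σ j ≡ x → ParentStep j x
  parentStep j (hub c) σj≡hub = record
    { parent       = zero
    ; edgeTo       = spokeEdge j c
    ; edgeTo∈      = trans (encode-spokeEdge σ j c) (trans (cong (usesSpoke c) σj≡hub) (usesSpoke-hub c))
    ; edgeTo-joins = spokeEdge-joins j c
    ; depth<       = s≤s z≤n
    }
  parentStep j right σj≡right = record
    { parent       = suc (suc l)
    ; edgeTo       = pathEdge l
    ; edgeTo∈      = trans (encode-pathEdge σ l) (cong (λ x → isRight x ∨ isLeft (lookup σ (suc l))) σl≡right)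
    ; edgeTo-joins = subst (λ i → Joins (edge G (pathEdge l)) (suc i) (suc (suc l))) l≡j (pathEdge-joins l)
    ; depth<       = next-depth (lookup σ (suc l)) (right⇒nextNotLeft valid l σl≡right)
    }
    where
    j≢last : k ≢ toℕ j
    j≢last = right⇒notLast valid j σj≡right
    l : Fin k
    l = lower₁ j j≢last
    l≡j : inject₁ l ≡ j
    l≡j = inject₁-lower₁ j j≢last
    σl≡right : lookup σ (inject₁ l) ≡ right
    σl≡right = trans (cong (lookup σ) l≡j) σj≡right
    next-depth : ∀ x → isLeft x ≡ false → labelDepth (suc l) x < 2 + (k ∸ toℕ j)
    next-depth (hub _) _ = s≤s (s≤s z≤n)
    next-depth right   _ rewrite toℕ-lower₁ j j≢last =
      s≤s (s≤s (ℕ.∸-monoʳ-< (ℕ.n<1+n (toℕ j)) (subst (_< k) (toℕ-lower₁ j j≢last) (toℕ<n l))))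
  parentStep zero left σ0≡left = contradiction (trans (sym (cong isLeft σ0≡left)) head-follows) λ ()
  parentStep (suc l) left σl≡left = record
    { parent       = suc (inject₁ l)
    ; edgeTo       = pathEdge l
    ; edgeTo∈      = trans (encode-pathEdge σ l)
                       (trans (cong (λ x → isRight (lookup σ (inject₁ l)) ∨ isLeft x) σl≡left) (∨-zeroʳ _))
    ; edgeTo-joins = Joins-sym (pathEdge-joins l)
    ; depth<       = previous-depth (lookup σ (inject₁ l)) (left⇒previousNotRight valid l σl≡left)
    }
    where
    previous-depth : ∀ x → isRight x ≡ false → labelDepth (inject₁ l) x < 2 + toℕ (suc l)
    previous-depth (hub _) _ = s≤s (s≤s z≤n)
    previous-depth left    _ rewrite toℕ-inject₁ l = ℕ.≤-refl

  open ParentStep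

  step : ∀ j → ParentStep j (lookup σ j)
  step j = parentStep j (lookup σ j) refl

  -- Stated for an arbitrary x so that they apply to step j once its label is known.
  edgeTo-hub : ∀ j x (σj≡x : lookup σ j ≡ x) c → x ≡ hub c → edgeTo (parentStep j x σj≡x) ≡ spokeEdge j c
  edgeTo-hub j _ _ c refl = refl

  edgeTo-right : ∀ l x (σl≡x : lookup σ (inject₁ l) ≡ x) → x ≡ right →
                 edgeTo (parentStep (inject₁ l) x σl≡x) ≡ pathEdge l
  edgeTo-right l _ _ refl = cong pathEdge (lower₁-inject₁′ l _)

  edgeTo-left : ∀ l x (σl≡x : lookup σ (suc l) ≡ x) → x ≡ left → edgeTo (parentStep (suc l) x σl≡x) ≡ pathEdge l
  edgeTo-left l _ _ refl = refl

  parentOf : Fin (V G) → Fin (V G)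
  parentOf zero    = zero
  parentOf (suc j) = parent (step j)

  parentEdgeOf : (v : Fin (V G)) → .(v ≢ zero) → Fin (m G)
  parentEdgeOf zero    z≢z = Irrelevant.⊥-elim (z≢z refl)
  parentEdgeOf (suc j) _   = edgeTo (step j)

  parentEdgeOf-onto : ∀ e → e ∈ₛ encode σ → Σ (Fin (V G)) λ v → Σ (v ≢ zero) λ v≢0 → parentEdgeOf v v≢0 ≡ e
  parentEdgeOf-onto e e∈S with edgeView e | []=⇒lookup e∈S
  ... | spoke j c | selected =
    suc j , (λ ()) , edgeTo-hub j _ refl c (usesSpoke⇒≡hub c _ (trans (sym (encode-spokeEdge σ j c)) selected))
  ... | path l | selected with isRight (lookup σ (inject₁ l)) in isRight≡
  ... | true  = suc (inject₁ l) , (λ ()) , edgeTo-right l _ refl (isRight⇒≡right _ isRight≡)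
  ... | false = suc (suc l) , (λ ()) , edgeTo-left l _ refl (isLeft⇒≡left _ isLeft≡)
    where
    isLeft≡ : isLeft (lookup σ (suc l)) ≡ true
    isLeft≡ = trans (sym (trans (encode-pathEdge σ l) (cong (_∨ isLeft (lookup σ (suc l))) isRight≡))) selected

  parentPointers : ParentPointers G (encode σ)
  parentPointers = record
    { root             = zero
    ; depth            = depth
    ; parent           = parentOf
    ; parentEdge       = parentEdgeOf
    ; parentEdge∈S     = λ { zero z≢z → Irrelevant.⊥-elim (z≢z refl)
                           ; (suc j) _ → lookup⇒[]= _ (encode σ) (edgeTo∈ (step j)) }
    ; parentEdge-joins = λ { zero z≢z → Irrelevant.⊥-elim (z≢z refl) ; (suc j) _ → edgeTo-joins (step j) }
    ; depth-parent     = λ { zero z≢z → contradiction refl z≢z ; (suc j) _ → depth< (step j) }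
    ; parentEdge-onto  = parentEdgeOf-onto
    }

  encode-spanningTree : IsSpanningTree G (encode σ)
  encode-spanningTree = parentPointers⇒spanningTree parentPointers

module FromSpanningTree (k a : ℕ) (S : Subset (m (Fan.G k a))) (tree : IsSpanningTree (Fan.G k a) S) where
  open Fan k a

  -- Positions are natural numbers so that the interval lemmas apply; PathEdgeAt i is vacuous for i ≥ k.
  PathEdgeAt : ℕ → Set
  PathEdgeAt i = ∀ l → toℕ l ≡ i → lookup S (pathEdge l) ≡ true

  open Intervals PathEdgeAt

  Linked : Fin (suc k) → Fin (suc k) → Set
  Linked i j = AllBetween (toℕ i) (toℕ j)

  pathEdgeAt : ∀ l → lookup S (pathEdge l) ≡ true → PathEdgeAt (toℕ l)
  pathEdgeAt l l∈S l′ l′≡l rewrite toℕ-injective l′≡l = l∈S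

  linked-right : ∀ {j l} → Linked j (inject₁ l) → lookup S (pathEdge l) ≡ true → Linked j (suc l)
  linked-right {j} {l} j~l l∈S =
    AllBetween-trans (subst (AllBetween (toℕ j)) (toℕ-inject₁ l) j~l) (AllBetween-step (toℕ l) (pathEdgeAt l l∈S))

  linked-left : ∀ {j l} → Linked j (suc l) → lookup S (pathEdge l) ≡ true → Linked j (inject₁ l)
  linked-left {j} {l} j~l l∈S =
    subst (AllBetween (toℕ j)) (sym (toℕ-inject₁ l))
          (AllBetween-trans j~l (AllBetween-sym (AllBetween-step (toℕ l) (pathEdgeAt l l∈S))))

  PathEdgeBelow : ℕ → Fin (m G) → Set
  PathEdgeBelow y e = Σ (Fin k) λ l → e ≡ pathEdge l × toℕ l < y

  Trail : Fin (suc k) → Fin (suc k) → Set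
  Trail x y = Σ (List (Fin (m G))) λ es → Walk G S (suc x) (suc y) es × All (PathEdgeBelow (toℕ y)) es × Unique es

  trail : ∀ y x → toℕ x ≤ toℕ y → Linked x y → Trail x y
  trail = <-weakInduction (λ y → ∀ x → toℕ x ≤ toℕ y → Linked x y → Trail x y) from-zero extend
    where
    from-zero : ∀ x → toℕ x ≤ 0 → Linked x zero → Trail x zero
    from-zero zero _ _ = [] , nil , [] , []
    extend : ∀ l → (∀ x → toℕ x ≤ toℕ (inject₁ l) → Linked x (inject₁ l) → Trail x (inject₁ l)) →
             ∀ x → toℕ x ≤ suc (toℕ l) → Linked x (suc l) → Trail x (suc l)
    extend l trail-l x x≤y x~y with x ≟ᶠ suc l
    ... | yes refl = [] , nil , [] , []
    ... | no x≢y   = append (ℕ.≤-pred (ℕ.≤∧≢⇒< x≤y (λ x≡y → x≢y (toℕ-injective x≡y))))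
      where
      append : toℕ x ≤ toℕ l → Trail x (suc l)
      append x≤l with trail-l x (subst (toℕ x ≤_) (sym (toℕ-inject₁ l)) x≤l)
                       (subst (AllBetween (toℕ x)) (sym (toℕ-inject₁ l)) (AllBetween-sub x~y x≤l (ℕ.n≤1+n (toℕ l))))
      ... | es , x⇝l , below , unique =
        es ++ pathEdge l ∷ [] ,
        x⇝l ++ʷ cons (pathEdge l) (lookup⇒[]= _ S (AllBetween-max x~y x≤l l refl)) (pathEdge-joins l) nil ,
        Allₚ.++⁺ (All.map weaken below) ((l , refl , ℕ.≤-refl) ∷ []) ,
        Unique.++⁺ unique ([] ∷ []) fresh
        where
        weaken : ∀ {e} → PathEdgeBelow (toℕ (inject₁ l)) e → PathEdgeBelow (suc (toℕ l)) e
        weaken (l′ , e≡l′ , l′<l) = l′ , e≡l′ , ℕ.m<n⇒m<1+n (subst (toℕ l′ <_) (toℕ-inject₁ l) l′<l)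
        fresh : ∀ {e} → ¬ (e ∈ es × e ∈ pathEdge l ∷ [])
        fresh (e∈es , here refl) with All.lookup below e∈es
        ... | l′ , l≡l′ , l′<l with ↑ˡ-injective _ l l′ l≡l′
        ... | refl = ℕ.<-irrefl (sym (toℕ-inject₁ l)) l′<l

  spokes-unique-ordered : ∀ {r c r′ c′} → lookup S (spokeEdge r c) ≡ true → lookup S (spokeEdge r′ c′) ≡ true →
                          toℕ r ≤ toℕ r′ → Linked r r′ → r ≡ r′ × c ≡ c′
  spokes-unique-ordered {r} {c} {r′} {c′} rc∈S rc′∈S r≤r′ r~r′ with spokeEdge r c ≟ᶠ spokeEdge r′ c′
  ... | yes same = spokeEdge-injective same
  ... | no different with trail r′ r r≤r′ r~r′
  ... | es , r⇝r′ , below , unique = contradiction cycle-unique (proj₂ tree zero _ _ cycle)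
    where
    cycle : Walk G S zero zero (spokeEdge r c ∷ es ++ spokeEdge r′ c′ ∷ [])
    cycle = cons _ (lookup⇒[]= _ S rc∈S) (Joins-sym (spokeEdge-joins r c))
              (r⇝r′ ++ʷ cons _ (lookup⇒[]= _ S rc′∈S) (spokeEdge-joins r′ c′) nil)
    notPath : ∀ j c {e} → PathEdgeBelow (toℕ r′) e → spokeEdge j c ≢ e
    notPath j c (l , refl , _) eq = pathEdge≢spokeEdge l j c (sym eq)
    cycle-unique : Unique (spokeEdge r c ∷ es ++ spokeEdge r′ c′ ∷ [])
    cycle-unique =
      Allₚ.++⁺ (All.map (notPath r c) below) (different ∷ []) ∷
      Unique.++⁺ unique ([] ∷ []) (λ { (e∈es , here refl) → notPath r′ c′ (All.lookup below e∈es) refl })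

  spokes-unique : ∀ {r c r′ c′} → lookup S (spokeEdge r c) ≡ true → lookup S (spokeEdge r′ c′) ≡ true →
                  Linked r r′ → r ≡ r′ × c ≡ c′
  spokes-unique {r} {c} {r′} {c′} rc∈S rc′∈S r~r′ with ℕ.≤-total (toℕ r) (toℕ r′)
  ... | inj₁ r≤r′ = spokes-unique-ordered rc∈S rc′∈S r≤r′ r~r′
  ... | inj₂ r′≤r with spokes-unique-ordered rc′∈S rc∈S r′≤r (AllBetween-sym r~r′)
  ... | refl , refl = refl , refl

  -- A spoke of S reached from p_j along path edges of S; it is unique because S is acyclic.
  record Anchor (j : Fin (suc k)) : Set where
    constructor anchor
    field
      position : Fin (suc k)
      colour   : Fin a
      spoke∈S  : lookup S (spokeEdge position colour) ≡ true
      linked   : Linked j position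
  open Anchor

  anchor-unique : ∀ {j} (A B : Anchor j) → position A ≡ position B × colour A ≡ colour B
  anchor-unique A B = spokes-unique (spoke∈S A) (spoke∈S B) (AllBetween-trans (AllBetween-sym (linked A)) (linked B))

  relink : ∀ {i j} → Linked i j → Anchor j → Anchor i
  relink i~j (anchor r c rc∈S j~r) = anchor r c rc∈S (AllBetween-trans i~j j~r)

  anchorFromWalk : ∀ j x {es} → Walk G S (suc x) zero es → Linked j x → Anchor j
  anchorFromWalk j x (cons e e∈S x—y w) j~x with edgeView e
  ... | spoke r c with spokeEdge-joins⁻ r c x—y
  ...   | refl , refl = anchor r c ([]=⇒lookup e∈S) j~x
  anchorFromWalk j x (cons e e∈S x—y w) j~x | path l with pathEdge-joins⁻ l x—y
  ... | inj₁ (refl , refl) = anchorFromWalk j (suc l) w (linked-right j~x ([]=⇒lookup e∈S))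
  ... | inj₂ (refl , refl) = anchorFromWalk j (inject₁ l) w (linked-left j~x ([]=⇒lookup e∈S))

  anchorOf : ∀ j → Anchor j
  anchorOf j = anchorFromWalk j j (proj₂ (proj₁ tree (suc j) zero)) (AllBetween-refl (toℕ j))

  label : ∀ {j} → Anchor j → Label a
  label {j} A = direction j (position A) (colour A)

  label-usesSpoke : ∀ {j} (A : Anchor j) c → usesSpoke c (label A) ≡ lookup S (spokeEdge j c)
  label-usesSpoke {j} A c = ⇔→≡ (mk⇔ to from)
    where
    to : usesSpoke c (label A) ≡ true → lookup S (spokeEdge j c) ≡ true
    to uses with direction-usesSpoke j (position A) (colour A) c uses
    ... | refl , refl = spoke∈S A
    from : lookup S (spokeEdge j c) ≡ true → usesSpoke c (label A) ≡ true
    from jc∈S with anchor-unique A (anchor j c jc∈S (AllBetween-refl (toℕ j)))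
    ... | refl , refl = trans (cong (usesSpoke c) (direction-self j c)) (usesSpoke-hub c)

  module _ (l : Fin k) where

    pathEdge⇒same-position : lookup S (pathEdge l) ≡ true → (A : Anchor (inject₁ l)) (B : Anchor (suc l)) →
                             position A ≡ position B
    pathEdge⇒same-position l∈S A B =
      proj₁ (anchor-unique A (relink (linked-right (AllBetween-refl (toℕ (inject₁ l))) l∈S) B))

    right⇒pathEdge : (A : Anchor (inject₁ l)) → isRight (label A) ≡ true → lookup S (pathEdge l) ≡ true
    right⇒pathEdge A A-right = AllBetween-min (linked A) (direction-right⇒< _ _ _ A-right) l (sym (toℕ-inject₁ l))

    left⇒pathEdge : (B : Anchor (suc l)) → isLeft (label B) ≡ true → lookup S (pathEdge l) ≡ true
    left⇒pathEdge B B-left = AllBetween-max (AllBetween-sym (linked B)) (ℕ.≤-pred (direction-left⇒< _ _ _ B-left)) l refl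

    label-pathEdge : (A : Anchor (inject₁ l)) (B : Anchor (suc l)) →
                     lookup S (pathEdge l) ≡ isRight (label A) ∨ isLeft (label B)
    label-pathEdge A B = ⇔→≡ (mk⇔ to from)
      where
      to : lookup S (pathEdge l) ≡ true → isRight (label A) ∨ isLeft (label B) ≡ true
      to l∈S with isRight (label A) in notRight
      ... | true  = refl
      ... | false = cong isLeft (direction-<⇒left (suc l) (position B) (colour B) B-before)
        where
        B-before : toℕ (position B) < suc (toℕ l)
        B-before = s≤s (subst (λ r → toℕ r ≤ toℕ l) (pathEdge⇒same-position l∈S A B)
                     (subst (toℕ (position A) ≤_) (toℕ-inject₁ l) (direction-notRight⇒≤ _ _ _ notRight)))
      from : isRight (label A) ∨ isLeft (label B) ≡ true → lookup S (pathEdge l) ≡ true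
      from with isRight (label A) in A-right
      ... | true  = λ _ → right⇒pathEdge A A-right
      ... | false = left⇒pathEdge B

    not-right-left : (A : Anchor (inject₁ l)) (B : Anchor (suc l)) → isRight (label A) ∧ isLeft (label B) ≡ false
    not-right-left A B with isRight (label A) in A-right | isLeft (label B) in B-left
    ... | false | _     = refl
    ... | true  | false = refl
    ... | true  | true  = contradiction (direction-left⇒< _ _ _ B-left) (ℕ.≤⇒≯ B-after)
      where
      B-after : suc (toℕ l) ≤ toℕ (position B)
      B-after = subst₂ (λ i r → i < toℕ r) (toℕ-inject₁ l) (pathEdge⇒same-position (right⇒pathEdge A A-right) A B)
                  (direction-right⇒< _ _ _ A-right)

  labelling : Vec (Label a) (suc k)
  labelling = tabulate (λ j → label (anchorOf j))

  lookup-labelling : ∀ j → lookup labelling j ≡ label (anchorOf j)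
  lookup-labelling j = lookup∘tabulate (λ j → label (anchorOf j)) j

  labelling-valid : Valid true labelling
  labelling-valid = record
    { head-follows     = first-notLeft
    ; last-notRight    = trans (cong isRight (lookup-labelling (fromℕ k))) last-notRight
    ; adjacent-follows = λ l → subst₂ (λ x y → isRight x ∧ isLeft y ≡ false)
                           (sym (lookup-labelling (inject₁ l))) (sym (lookup-labelling (suc l)))
                           (not-right-left l (anchorOf (inject₁ l)) (anchorOf (suc l)))
    }
    where
    first-notLeft : isLeft (label (anchorOf zero)) ≡ false
    first-notLeft with isLeft (label (anchorOf zero)) in first-left
    ... | false = refl
    ... | true  with direction-left⇒< _ _ _ first-left
    ... | ()
    last-notRight : isRight (label (anchorOf (fromℕ k))) ≡ false
    last-notRight with isRight (label (anchorOf (fromℕ k))) in last-right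
    ... | false = refl
    ... | true  = contradiction (subst (_< toℕ r) (toℕ-fromℕ k) (direction-right⇒< _ _ _ last-right))
                                (ℕ.≤⇒≯ (ℕ.≤-pred (toℕ<n r)))
      where r = position (anchorOf (fromℕ k))

  encode-labelling : encode labelling ≡ S
  encode-labelling = Subset-ext (encode labelling) S same-path same-spoke
    where
    same-path : ∀ l → lookup (encode labelling) (pathEdge l) ≡ lookup S (pathEdge l)
    same-path l = begin
      lookup (encode labelling) (pathEdge l)
        ≡⟨ encode-pathEdge labelling l ⟩
      isRight (lookup labelling (inject₁ l)) ∨ isLeft (lookup labelling (suc l))
        ≡⟨ cong₂ (λ x y → isRight x ∨ isLeft y) (lookup-labelling (inject₁ l)) (lookup-labelling (suc l)) ⟩
      isRight (label (anchorOf (inject₁ l))) ∨ isLeft (label (anchorOf (suc l)))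
        ≡⟨ sym (label-pathEdge l (anchorOf (inject₁ l)) (anchorOf (suc l))) ⟩
      lookup S (pathEdge l) ∎
      where open ≡-Reasoning
    same-spoke : ∀ j c → lookup (encode labelling) (spokeEdge j c) ≡ lookup S (spokeEdge j c)
    same-spoke j c = trans (encode-spokeEdge labelling j c)
                       (trans (cong (usesSpoke c) (lookup-labelling j)) (label-usesSpoke (anchorOf j) c))

-- Counting

fan-spanningTreeCount : ∀ k a → SpanningTreeCount (fan (suc k) a) (chainCount {a} (suc k) true)
fan-spanningTreeCount k a = map encode labellings , unique , (λ S → mk⇔ (tree S) (listed S)) , count
  where
  open Fan k a
  labellings : List (Vec (Label a) (suc k))
  labellings = chains (suc k) true
  valid : ∀ {σ} → σ ∈ labellings → Valid true σ
  valid σ∈ = Equivalence.to (Chain⇔Valid true _) (Equivalence.to (∈chains⇔Chain (suc k) true _) σ∈)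
  unique : Unique (map encode labellings)
  unique = map-unique-on encode (encode-injective) (All.tabulate valid) (chains-unique (suc k) true)
  tree : ∀ S → S ∈ map encode labellings → IsSpanningTree G S
  tree S S∈ with ∈-map⁻ encode S∈
  ... | σ , σ∈ , refl = FromLabelling.encode-spanningTree k a σ (valid σ∈)
  listed : ∀ S → IsSpanningTree G S → S ∈ map encode labellings
  listed S S-tree = subst (_∈ map encode labellings) encode-labelling
    (∈-map⁺ encode (Equivalence.from (∈chains⇔Chain (suc k) true labelling)
                     (Equivalence.from (Chain⇔Valid true labelling) labelling-valid)))
    where open FromSpanningTree k a S S-tree
  count : length (map encode labellings) ≡ chainCount (suc k) true
  count = trans (length-map encode labellings) (length-chains (suc k) true)

followCount-ℤ : ∀ a (h : Bool → ℕ) →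
  (+ followCount {a} h true ≡ + a ℤ.* + h false ℤ.+ + h true) ×
  (+ followCount {a} h false ≡ + a ℤ.* + h false ℤ.+ (+ h false ℤ.+ + h true))
followCount-ℤ a h =
  trans (pos-+ (a * h false) (h true)) (cong (ℤ._+ + h true) (pos-* a (h false))) ,
  trans (pos-+ (a * h false) _) (cong₂ ℤ._+_ (pos-* a (h false)) (pos-+ (h false) (h true)))

chainCount-MorganVoyce : ∀ a n →
  (+ chainCount {a} (suc n) true ≡ + a ℤ.* B n (+ a)) ×
  (+ chainCount {a} (suc n) false ≡ B (suc n) (+ a) ℤ.- B n (+ a))
chainCount-MorganVoyce a zero with followCount-ℤ a (chainCount {a} zero)
... | t≡ , f≡ = trans t≡ (base-true (+ a)) , trans f≡ (base-false (+ a))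
  where
  base-true : ∀ x → x ℤ.* + 1 ℤ.+ + 0 ≡ x ℤ.* + 1
  base-true = solve-∀
  base-false : ∀ x → x ℤ.* + 1 ℤ.+ (+ 1 ℤ.+ + 0) ≡ (+ 2 ℤ.+ x) ℤ.- + 1
  base-false = solve-∀
chainCount-MorganVoyce a (suc n) with chainCount-MorganVoyce a n | followCount-ℤ a (chainCount {a} (suc n))
... | t≡ , f≡ | t-step , f-step =
  trans t-step (trans (cong₂ (λ d t → x ℤ.* d ℤ.+ t) f≡ t≡) (step-true x (B (suc n) x) (B n x))) ,
  trans f-step (trans (cong₂ (λ d t → x ℤ.* d ℤ.+ (d ℤ.+ t)) f≡ t≡) (step-false x (B (suc n) x) (B n x)))
  where
  x : ℤ
  x = + a
  step-true : ∀ x b₁ b₀ → x ℤ.* (b₁ ℤ.- b₀) ℤ.+ x ℤ.* b₀ ≡ x ℤ.* b₁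
  step-true = solve-∀
  step-false : ∀ x b₁ b₀ →
    x ℤ.* (b₁ ℤ.- b₀) ℤ.+ ((b₁ ℤ.- b₀) ℤ.+ x ℤ.* b₀) ≡ (x ℤ.+ + 2) ℤ.* b₁ ℤ.- b₀ ℤ.- b₁
  step-false = solve-∀

chainCount-fib : ∀ n → chainCount {1} n true ≡ fib (2 * n) × chainCount {1} n false ≡ fib (suc (2 * n))
chainCount-fib zero = refl , refl
chainCount-fib (suc n) with chainCount-fib n
... | t≡ , f≡ = step-true , step-false
  where
  open ≡-Reasoning
  F₀ F₁ : ℕ
  F₀ = fib (2 * n)
  F₁ = fib (suc (2 * n))
  step-true : chainCount {1} (suc n) true ≡ fib (2 * suc n)
  step-true = begin
    1 * chainCount n false + chainCount n true  ≡⟨ cong₂ (λ f t → 1 * f + t) f≡ t≡ ⟩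
    1 * F₁ + F₀                                 ≡⟨ cong (_+ F₀) (ℕ.*-identityˡ F₁) ⟩
    fib (2 + 2 * n)                             ≡⟨ cong fib (sym (ℕ.*-suc 2 n)) ⟩
    fib (2 * suc n)                             ∎
  step-false : chainCount {1} (suc n) false ≡ fib (suc (2 * suc n))
  step-false = begin
    1 * chainCount n false + (chainCount n false + chainCount n true)
      ≡⟨ cong₂ (λ f t → 1 * f + (f + t)) f≡ t≡ ⟩
    1 * F₁ + (F₁ + F₀)     ≡⟨ cong (_+ (F₁ + F₀)) (ℕ.*-identityˡ F₁) ⟩
    F₁ + (F₁ + F₀)         ≡⟨ ℕ.+-comm F₁ (F₁ + F₀) ⟩
    fib (3 + 2 * n)        ≡⟨ cong (fib ∘ suc) (sym (ℕ.*-suc 2 n)) ⟩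
    fib (suc (2 * suc n))  ∎

-- The bounds on a and n are only needed to exclude n = 0.
theorem5p9 : (a n : ℕ) → 1 ≤ a → 2 ≤ n →
    Σ ℕ (λ t → SpanningTreeCount (fan n a) t × (+ t ≡ + a ℤ.* B (n ∸ 1) (+ a)))
    × (a ≡ 1 → SpanningTreeCount (fan n a) (fib (2 * n)))
theorem5p9 a zero    _ ()
theorem5p9 a (suc k) _ _ =
  (chainCount (suc k) true , fan-spanningTreeCount k a , proj₁ (chainCount-MorganVoyce a k)) ,
  λ { refl → subst (SpanningTreeCount (fan (suc k) 1)) (proj₁ (chainCount-fib (suc k))) (fan-spanningTreeCount k 1) }
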